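{- Let $G$ be a connected graph of order $n\geq 3$ that contains a bridge, and let $b$ be the maximum number of bridges incident with a single vertex of $G$. Then $tpc(G)\geq b+1$.
   Context: All graphs are simple, finite and undirected. A graph is total-colored if every vertex and every edge receives a color. A path $v_1v_2\ldots v_s$ in a total-colored graph is a total proper path if (i) any two adjacent edges on the path have different colors, (ii) any two adjacent internal vertices of the path (vertices among $v_2,\ldots,v_{s-1}$) have different colors, and (iii) every internal vertex of the path has a color different from the colors of its two incident edges on the path. A total-colored graph is total proper connected if every two vertices are joined by a total proper path. For a connected graph $G$, the total proper connection number $tpc(G)$ is the smallest number of colors in a total-coloring making $G$ total proper connected. -}

module Defs where

open import Data.Nat using (ℕ; _≤_)
open import Data.Bool using (Bool; true; false; _∧_; _∨_; not)
open import Data.Fin using (Fin; _≟_)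
open import Data.Fin.Subset using (Subset; _∈_; ∣_∣)
open import Data.List using (List; []; _∷_; head; last)
open import Data.List.Relation.Unary.Unique.Propositional using (Unique)
open import Data.Maybe using (just)
open import Data.Product using (Σ; _×_)
open import Data.Unit using (⊤)
open import Relation.Nullary using (¬_)
open import Relation.Nullary.Decidable using (⌊_⌋)
open import Relation.Binary.PropositionalEquality using (_≡_; _≢_; refl; cong₂)
open import Data.Bool.Properties using (∨-comm)

record Graph (n : ℕ) : Set where
  field
    adj       : Fin n → Fin n → Bool
    adj-sym   : ∀ x y → adj x y ≡ adj y x
    adj-irrefl : ∀ x → adj x x ≡ false
open Graph public

Edge : ∀ {n} → Graph n → Fin n → Fin n → Set
Edge G x y = adj G x y ≡ true

Chain : ∀ {n} → Graph n → List (Fin n) → Set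
Chain G (x ∷ y ∷ rest) = Edge G x y × Chain G (y ∷ rest)
Chain G _ = ⊤

IsPath : ∀ {n} → Graph n → Fin n → Fin n → List (Fin n) → Set
IsPath G x y p = (head p ≡ just x) × (last p ≡ just y) × Unique p × Chain G p

Connected : ∀ {n} → Graph n → Set
Connected G = ∀ x y → Σ _ (IsPath G x y)

deleteEdge : ∀ {n} → Graph n → Fin n → Fin n → Graph n
deleteEdge {n} G u v = record
  { adj = λ x y → adj G x y ∧ not (isUV x y)
  ; adj-sym = sym'
  ; adj-irrefl = irr }
  where
  pairUV : Fin n → Fin n → Bool
  pairUV x y = ⌊ x ≟ u ⌋ ∧ ⌊ y ≟ v ⌋
  isUV : Fin n → Fin n → Bool
  isUV x y = pairUV x y ∨ pairUV y x
  sym' : ∀ x y → (adj G x y ∧ not (isUV x y)) ≡ (adj G y x ∧ not (isUV y x))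
  sym' x y = cong₂ (λ a c → a ∧ not c) (adj-sym G x y) (∨-comm (pairUV x y) (pairUV y x))
  irr : ∀ x → (adj G x x ∧ not (isUV x x)) ≡ false
  irr x rewrite adj-irrefl G x = refl

IsBridge : ∀ {n} → Graph n → Fin n → Fin n → Set
IsBridge G u v = Edge G u v × ¬ Connected (deleteEdge G u v)

HasBridge : ∀ {n} → Graph n → Set
HasBridge {n} G = Σ (Fin n) λ u → Σ (Fin n) λ v → IsBridge G u v

BridgeDegree : ∀ {n} → Graph n → Fin n → ℕ → Set
BridgeDegree {n} G v d =
  Σ (Subset n) λ S → (∀ u → (u ∈ S → IsBridge G v u) × (IsBridge G v u → u ∈ S)) × ∣ S ∣ ≡ d

IsMaxBridgeDegree : ∀ {n} → Graph n → ℕ → Set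
IsMaxBridgeDegree {n} G b =
  (Σ (Fin n) λ v → BridgeDegree G v b) × (∀ v d → BridgeDegree G v d → d ≤ b)

-- Total colourings with k colours: vertex colours vc, edge colours ec
-- (ec is symmetric, so ec x y is the colour of the edge xy).
SymmetricEdgeColouring : ∀ {n k} → (Fin n → Fin n → Fin k) → Set
SymmetricEdgeColouring ec = ∀ x y → ec x y ≡ ec y x

module _ {n k : ℕ} (vc : Fin n → Fin k) (ec : Fin n → Fin n → Fin k) where
  TripleCond : List (Fin n) → Set
  TripleCond (a ∷ b ∷ c ∷ rest) =
    (ec a b ≢ ec b c) × (vc b ≢ ec a b) × (vc b ≢ ec b c) × TripleCond (b ∷ c ∷ rest)
  TripleCond _ = ⊤

  -- (ii) adjacent internal vertices have different colours
  InnerCond : List (Fin n) → Set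
  InnerCond (a ∷ b ∷ c ∷ d ∷ rest) = (vc b ≢ vc c) × InnerCond (b ∷ c ∷ d ∷ rest)
  InnerCond _ = ⊤

  TotalProper : List (Fin n) → Set
  TotalProper p = TripleCond p × InnerCond p

TotalProperConnected : ∀ {n k} → Graph n → (Fin n → Fin k) → (Fin n → Fin n → Fin k) → Set
TotalProperConnected G vc ec =
  ∀ x y → Σ _ λ p → IsPath G x y p × TotalProper vc ec p

-- A vertex v incident with bridges vu₁, …, vu_b is the only way between any two
-- of the uᵢ: the unique path from uᵢ to uⱼ is uᵢ v uⱼ.  In a total proper colouring
-- this path forces the edge colours c(vuᵢ) to be pairwise distinct and different
-- from the colour of v, which gives b + 1 colours once b ≥ 2.  For b ≤ 1 it
-- suffices to see two colours: with a bridge ac and a third vertex w, one of the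
-- total proper paths from a and from c to w must cross ac, so it has a or c as an
-- internal vertex whose colour differs from that of the edge ac.
module Submission where

open import Defs
open import Data.Nat using (ℕ; zero; suc; _≤_; z≤n; s≤s; _≤?_)
open import Data.Nat.Properties using (≤-trans; ≰⇒>)
open import Data.Fin using (Fin; zero; suc; _≟_; punchIn; punchOut)
open import Data.Fin.Properties
  using ( any?; 0≢1+n; suc-injective
        ; punchInᵢ≢i; punchIn-injective; punchIn-punchOut; punchOut-injective )
open import Data.Fin.Subset using (Subset; _∈_; ∣_∣; ⁅_⁆; inside; outside)
open import Data.Fin.Subset.Properties using (_∈?_; x∈⁅x⁆; ∣⁅x⁆∣≡1; p⊆q⇒∣p∣≤∣q∣)
open import Data.Vec using ([]; _∷_; here; there)
open import Data.Bool using (not; _∧_; _∨_)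
open import Data.Bool.Properties using (∨-comm; ∧-comm)
open import Data.List using ([]; _∷_; last)
open import Data.List.Relation.Unary.All as All using (All; []; _∷_; universal)
open import Data.List.Relation.Unary.All.Properties using (¬Any⇒All¬)
open import Data.List.Relation.Unary.Any using (Any; here; there)
import Data.List.Relation.Unary.Any as Any
open import Data.List.Relation.Unary.AllPairs using ([]; _∷_)
open import Data.List.Relation.Unary.Unique.Propositional using (Unique)
open import Data.Maybe using (just)
open import Data.Maybe.Properties using (just-injective)
open import Data.Product using (Σ; ∃; _×_; _,_; proj₁; proj₂)
open import Data.Sum using (_⊎_; inj₁; inj₂)
open import Data.Unit using (⊤; tt)
open import Data.Empty using (⊥-elim)
open import Function using (_∘_)
open import Relation.Nullary using (¬_; yes; no; ¬?; contradiction)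
open import Relation.Nullary.Decidable using (⌊_⌋; _×-dec_)
open import Relation.Binary.PropositionalEquality
open import Relation.Binary.Construct.Closure.ReflexiveTransitive
  using (Star; ε; _◅_; _◅◅_; reverse)
  renaming (map to Star-map)

private
  variable
    n k : ℕ

InjectiveOn : ∀ {A : Set} (S : Subset n) → (∀ i → i ∈ S → A) → Set
InjectiveOn S f = ∀ {i j} (i∈S : i ∈ S) (j∈S : j ∈ S) → f i i∈S ≡ f j j∈S → i ≡ j

mutual
  injectiveOn⇒∣p∣≤ : (S : Subset n) (f : ∀ i → i ∈ S → Fin k) →
                     InjectiveOn S f → ∣ S ∣ ≤ k
  injectiveOn⇒∣p∣≤ []            f inj = z≤n
  injectiveOn⇒∣p∣≤ (outside ∷ S) f inj =
    injectiveOn⇒∣p∣≤ S (λ i → f (suc i) ∘ there) (λ p q → suc-injective ∘ inj (there p) (there q))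
  injectiveOn⇒∣p∣≤ (inside ∷ S)  f inj =
    injectiveOn-avoiding⇒∣p∣< S (f zero here) (λ i → f (suc i) ∘ there)
      (λ p q → suc-injective ∘ inj (there p) (there q))
      (λ p → 0≢1+n ∘ inj here (there p) ∘ sym)

  injectiveOn-avoiding⇒∣p∣< : (S : Subset n) (c : Fin k) (f : ∀ i → i ∈ S → Fin k) →
                              InjectiveOn S f → (∀ {i} (i∈S : i ∈ S) → f i i∈S ≢ c) →
                              suc ∣ S ∣ ≤ k
  injectiveOn-avoiding⇒∣p∣< {k = suc _} S c f inj avoids =
    s≤s (injectiveOn⇒∣p∣≤ S (λ i i∈S → punchOut (avoids i∈S ∘ sym))
      (λ p q → inj p q ∘ punchOut-injective (avoids p ∘ sym) (avoids q ∘ sym)))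

two-distinct⇒2≤ : {x y : Fin k} → x ≢ y → 2 ≤ k
two-distinct⇒2≤ {k = suc zero}    {zero} {zero} x≢y = contradiction refl x≢y
two-distinct⇒2≤ {k = suc (suc _)}               _   = s≤s (s≤s z≤n)

3≤n⇒third-vertex : 3 ≤ n → (a c : Fin n) → ∃ λ w → w ≢ a × w ≢ c
3≤n⇒third-vertex (s≤s (s≤s (s≤s _))) a c with a ≟ c
... | yes refl = punchIn a zero , punchInᵢ≢i a zero , punchInᵢ≢i a zero
... | no a≢c   = punchIn a w′ , punchInᵢ≢i a w′ , w≢c
  where
  j  = punchOut a≢c
  w′ = punchIn j zero
  w≢c : punchIn a w′ ≢ c
  w≢c w≡c = punchInᵢ≢i j zero
    (punchIn-injective a w′ j (trans w≡c (sym (punchIn-punchOut a≢c))))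

∣p∣≥2⇒another : (S : Subset n) → 2 ≤ ∣ S ∣ → ∀ u → ∃ λ u′ → u′ ∈ S × u′ ≢ u
∣p∣≥2⇒another S 2≤∣S∣ u with any? (λ i → (i ∈? S) ×-dec ¬? (i ≟ u))
... | yes found = found
... | no none   = contradiction ∣S∣≤1 (λ { (s≤s ()) })
  where
  S⊆⁅u⁆ : ∀ {i} → i ∈ S → i ∈ ⁅ u ⁆
  S⊆⁅u⁆ {i} i∈S with i ≟ u
  ... | yes refl = x∈⁅x⁆ u
  ... | no i≢u   = contradiction (i , i∈S , i≢u) none
  ∣S∣≤1 : 2 ≤ 1
  ∣S∣≤1 = ≤-trans 2≤∣S∣ (subst (∣ S ∣ ≤_) (∣⁅x⁆∣≡1 u) (p⊆q⇒∣p∣≤∣q∣ S⊆⁅u⁆))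

Walk : Graph n → Fin n → Fin n → Set
Walk G = Star (Edge G)

module _ (G : Graph n) where

  edge-sym : ∀ {x y} → Edge G x y → Edge G y x
  edge-sym {x} {y} = trans (adj-sym G y x)

  edge⇒≢ : ∀ {x y} → Edge G x y → x ≢ y
  edge⇒≢ {x} e refl with trans (sym e) (adj-irrefl G x)
  ... | ()

  deleteEdge-edge : ∀ {a c x y} → Edge G x y → (x ≡ a → y ≢ c) → (x ≡ c → y ≢ a) →
                    Edge (deleteEdge G a c) x y
  deleteEdge-edge {a} {c} {x} {y} e not-ac not-ca
    with x ≟ a | y ≟ c | y ≟ a | x ≟ c
  ... | yes x≡a | yes y≡c | _       | _       = contradiction y≡c (not-ac x≡a)
  ... | _       | _       | yes y≡a | yes x≡c = contradiction y≡a (not-ca x≡c)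
  ... | no _    | _       | no _    | _       rewrite e = refl
  ... | no _    | _       | yes _   | no _    rewrite e = refl
  ... | yes _   | no _    | no _    | _       rewrite e = refl
  ... | yes _   | no _    | yes _   | no _    rewrite e = refl

  deleteEdge-comm : ∀ {a c x y} → Edge (deleteEdge G a c) x y → Edge (deleteEdge G c a) x y
  deleteEdge-comm {a} {c} {x} {y} = trans (cong (λ t → adj G x y ∧ not t) (sym ac≡ca))
    where
    ac≡ca : (⌊ x ≟ a ⌋ ∧ ⌊ y ≟ c ⌋ ∨ ⌊ y ≟ a ⌋ ∧ ⌊ x ≟ c ⌋) ≡
            (⌊ x ≟ c ⌋ ∧ ⌊ y ≟ a ⌋ ∨ ⌊ y ≟ c ⌋ ∧ ⌊ x ≟ a ⌋)
    ac≡ca = trans (∨-comm (⌊ x ≟ a ⌋ ∧ ⌊ y ≟ c ⌋) (⌊ y ≟ a ⌋ ∧ ⌊ x ≟ c ⌋))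
                  (cong₂ _∨_ (∧-comm ⌊ y ≟ a ⌋ ⌊ x ≟ c ⌋) (∧-comm ⌊ x ≟ a ⌋ ⌊ y ≟ c ⌋))

  chain⇒star : ∀ {P : Fin n → Set} {R : Fin n → Fin n → Set} →
               (∀ {y z} → P y → P z → Edge G y z → R y z) →
               ∀ {x y} p → All P (x ∷ p) → Chain G (x ∷ p) → last (x ∷ p) ≡ just y → Star R x y
  chain⇒star lift []      _              _        refl = ε
  chain⇒star lift (z ∷ p) (Px ∷ Pz ∷ Pp) (e , ch) lp   =
    lift Px Pz e ◅ chain⇒star lift p (Pz ∷ Pp) ch lp

  path⇒walk : ∀ {x y p} → IsPath G x y p → Walk G x y
  path⇒walk {p = x ∷ p} (refl , lp , _ , ch) =
    chain⇒star {P = λ _ → ⊤} (λ _ _ e → e) p (universal _ _) ch lp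

  -- A path leaving a along an edge other than ac never comes back to a.
  path⇒walk-deleteEdge : ∀ {a c t y rest} → IsPath G a t (a ∷ y ∷ rest) → y ≢ c →
                         Walk (deleteEdge G a c) a t
  path⇒walk-deleteEdge (_ , lp , a∉ ∷ _ , e , ch) y≢c =
    deleteEdge-edge e (λ _ → y≢c) (λ _ y≡a → All.head a∉ (sym y≡a)) ◅
    chain⇒star (λ a≢y a≢z e → deleteEdge-edge e (λ y≡a → contradiction (sym y≡a) a≢y)
                                                 (λ _ z≡a → a≢z (sym z≡a)))
               _ a∉ ch lp

last-∉ : ∀ {A : Set} {x y : A} p → All (x ≢_) (y ∷ p) → last (y ∷ p) ≢ just x
last-∉ []      (x≢y ∷ _) eq = x≢y (sym (just-injective eq))
last-∉ (z ∷ p) (_ ∷ x∉)  eq = last-∉ p x∉ eq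

module _ (H : Graph n) where

  path-from-member : ∀ {x z} p → Any (x ≡_) p → last p ≡ just z → Unique p → Chain H p →
                     Σ _ (IsPath H x z)
  path-from-member (q ∷ p)     (here refl) lp up       ch       = q ∷ p , refl , lp , up , ch
  path-from-member (q ∷ r ∷ p) (there x∈)  lp (_ ∷ up) (_ , ch) =
    path-from-member (r ∷ p) x∈ lp up ch

  walk⇒path : ∀ {x y} → Walk H x y → Σ _ (IsPath H x y)
  walk⇒path {x} ε = x ∷ [] , refl , refl , [] ∷ [] , tt
  walk⇒path {x} (e ◅ w) with walk⇒path w
  ... | p , hp , lp , up , ch with Any.any? (x ≟_) p
  ...   | yes x∈p = path-from-member p x∈p lp up ch
  walk⇒path {x} (e ◅ w) | q ∷ p , refl , lp , up , ch | no x∉p =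
    x ∷ q ∷ p , refl , lp , ¬Any⇒All¬ _ x∉p ∷ up , e , ch

module _ {G : Graph n} (connected : Connected G) where

  -- Every walk of G into a can be rerouted around ac, so such a detour would keep
  -- G - ac connected.
  bridge⇒no-detour : ∀ {a c} → IsBridge G a c → ¬ Walk (deleteEdge G a c) c a
  bridge⇒no-detour {a} {c} (_ , disconnected) c⇝a =
    disconnected λ x y → walk⇒path H (to-a x ◅◅ reverse (edge-sym H) (to-a y))
    where
    H = deleteEdge G a c
    reroute : ∀ {x} → Walk G x a → Walk H x a
    reroute ε = ε
    reroute {x} (e ◅ w) with x ≟ a | x ≟ c
    ... | yes refl | _        = ε
    ... | no _     | yes refl = c⇝a
    ... | no x≢a   | no x≢c   = deleteEdge-edge G e (⊥-elim ∘ x≢a) (⊥-elim ∘ x≢c) ◅ reroute w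
    to-a : ∀ x → Walk H x a
    to-a x = reroute (path⇒walk G (proj₂ (connected x a)))

  bridges⇒path-via : ∀ {v u u′} → IsBridge G v u → IsBridge G v u′ → u ≢ u′ →
                     ∀ p → IsPath G u u′ p → p ≡ u ∷ v ∷ u′ ∷ []
  bridges⇒path-via _ _ u≢u′ []       (() , _)
  bridges⇒path-via _ _ u≢u′ (_ ∷ []) (refl , refl , _) = contradiction refl u≢u′
  bridges⇒path-via {v} vu vu′ u≢u′ (_ ∷ y ∷ _) path@(refl , _) with y ≟ v
  ... | no y≢v =
    contradiction (Star-map (deleteEdge-comm G) (path⇒walk-deleteEdge G path y≢v) ◅◅ u′v ◅ ε)
                  (bridge⇒no-detour vu)
    where
    u′v = deleteEdge-edge G (edge-sym G (proj₁ vu′))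
            (λ u′≡v → contradiction (sym u′≡v) (edge⇒≢ G (proj₁ vu′)))
            (λ u′≡u → contradiction (sym u′≡u) u≢u′)
  bridges⇒path-via vu vu′ u≢u′ (_ ∷ v ∷ []) (refl , refl , _) | yes refl =
    contradiction refl (edge⇒≢ G (proj₁ vu′))
  bridges⇒path-via {v} {u′ = u′} vu vu′ u≢u′ (_ ∷ v ∷ z ∷ r) (refl , lp , _ ∷ up , _ , ch)
    | yes refl with z ≟ u′
  ... | no z≢u′ =
    contradiction (reverse (edge-sym (deleteEdge G v u′))
                           (path⇒walk-deleteEdge G (refl , lp , up , ch) z≢u′))
                  (bridge⇒no-detour vu′)
  ... | yes refl with r | up
  ...   | []     | _          = refl
  ...   | _ ∷ r′ | _ ∷ z∉ ∷ _ = contradiction lp (last-∉ r′ z∉)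

module _ {G : Graph n} (connected : Connected G)
         {vc : Fin n → Fin k} {ec : Fin n → Fin n → Fin k}
         (total-proper : TotalProperConnected G vc ec) where

  2≤k-or-path-avoids-bridge : ∀ {a c w p} → IsPath G a w p → TotalProper vc ec p →
                              w ≢ a → w ≢ c → 2 ≤ k ⊎ Walk (deleteEdge G a c) a w
  2≤k-or-path-avoids-bridge {p = []}    (() , _)
  2≤k-or-path-avoids-bridge {p = _ ∷ []} (refl , refl , _) _ w≢a _ = contradiction refl w≢a
  2≤k-or-path-avoids-bridge {c = c} {p = _ ∷ y ∷ _} path@(refl , _) tp _ _ with y ≟ c
  ... | no y≢c = inj₂ (path⇒walk-deleteEdge G path y≢c)
  2≤k-or-path-avoids-bridge {p = _ ∷ _ ∷ []}    (refl , refl , _) _ _ w≢c | yes refl =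
    contradiction refl w≢c
  2≤k-or-path-avoids-bridge {p = _ ∷ _ ∷ _ ∷ _} (refl , _) ((_ , vc≢ec , _) , _) _ _ | yes refl =
    inj₁ (two-distinct⇒2≤ vc≢ec)

  bridge⇒2≤k : ∀ {a c w} → IsBridge G a c → w ≢ a → w ≢ c → 2 ≤ k
  bridge⇒2≤k {a} {c} {w} bridge w≢a w≢c
    with total-proper a w | total-proper c w
  ... | _ , path-a , tp-a | _ , path-c , tp-c
    with 2≤k-or-path-avoids-bridge path-a tp-a w≢a w≢c
       | 2≤k-or-path-avoids-bridge path-c tp-c w≢c w≢a
  ... | inj₁ 2≤k | _        = 2≤k
  ... | inj₂ _   | inj₁ 2≤k = 2≤k
  ... | inj₂ a⇝w | inj₂ c⇝w =
    contradiction (Star-map (deleteEdge-comm G) c⇝w ◅◅ reverse (edge-sym (deleteEdge G a c)) a⇝w)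
                  (bridge⇒no-detour connected bridge)

  module _ (ec-sym : SymmetricEdgeColouring ec) {v : Fin n} (S : Subset n)
           (bridges : ∀ {u} → u ∈ S → IsBridge G v u) where

    centre-colours-distinct : ∀ {u u′} → u ∈ S → u′ ∈ S → u ≢ u′ →
                              (ec u v ≢ ec v u′) × (vc v ≢ ec v u′)
    centre-colours-distinct {u} {u′} u∈S u′∈S u≢u′ with total-proper u u′
    ... | p , path , tp with bridges⇒path-via connected (bridges u∈S) (bridges u′∈S) u≢u′ p path
    ... | refl with tp
    ... | (ec≢ec , _ , vc≢ec , _) , _ = ec≢ec , vc≢ec

    bridges⇒∣p∣<k : 2 ≤ ∣ S ∣ → suc ∣ S ∣ ≤ k
    bridges⇒∣p∣<k 2≤∣S∣ = injectiveOn-avoiding⇒∣p∣< S (vc v) (λ u _ → ec v u) injective avoids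
      where
      injective : InjectiveOn S (λ u _ → ec v u)
      injective {u} {u′} u∈S u′∈S eq with u ≟ u′
      ... | yes u≡u′ = u≡u′
      ... | no u≢u′  = contradiction (trans (ec-sym u v) eq)
                                     (proj₁ (centre-colours-distinct u∈S u′∈S u≢u′))
      avoids : ∀ {u} (u∈S : u ∈ S) → ec v u ≢ vc v
      avoids {u} u∈S with ∣p∣≥2⇒another S 2≤∣S∣ u
      ... | u′ , u′∈S , u′≢u = proj₂ (centre-colours-distinct u′∈S u∈S u′≢u) ∘ sym

proposition2 : ∀ (n : ℕ) (G : Graph n) → 3 ≤ n → Connected G → HasBridge G →
    ∀ (b : ℕ) → IsMaxBridgeDegree G b →
    ∀ (k : ℕ) (vc : Fin n → Fin k) (ec : Fin n → Fin n → Fin k) →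
    SymmetricEdgeColouring ec → TotalProperConnected G vc ec → suc b ≤ k
proposition2 n G 3≤n connected (a , c , bridge) .(∣ S ∣) ((v , S , bridges-at-v , refl) , _)
             k vc ec ec-sym total-proper
  with 2 ≤? ∣ S ∣
... | yes 2≤∣S∣ = bridges⇒∣p∣<k connected total-proper ec-sym S (proj₁ (bridges-at-v _)) 2≤∣S∣
... | no 2≰∣S∣  =
  let _ , w≢a , w≢c = 3≤n⇒third-vertex 3≤n a c
  in ≤-trans (≰⇒> 2≰∣S∣) (bridge⇒2≤k connected total-proper bridge w≢a w≢c)
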